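{- Consider the three two-vertex Boolean networks $(f_1,f_2)$: $[1,00,01,11]$: $f_1=x_1\land x_2,f_2=x_2$; $[2,00,01,11]$: $f_1=x_1\land x_2,f_2=x_1\lor x_2$; $[3,00,01,11]$: $f_1=x_1,f_2=x_1\lor x_2$. For any delay vector $(\alpha,\beta)$, every MBN built on one of these networks has exactly three attractors, the fixed points $(0,0)$, $(0,\beta)$ and $(\alpha,\beta)$.
   Context: The MBN built on a two-vertex Boolean network $(f_1,f_2)$ with delay vector $(\alpha,\beta)$ of positive integers has configurations $(\rho,\gamma)$ with $0\le\rho\le\alpha$, $0\le\gamma\le\beta$, underlying Boolean state $x=([\rho\ge1],[\gamma\ge1])$, and dynamics: the first coordinate becomes $\alpha$ if $f_1(x)=1$, else $\max(\rho-1,0)$; the second becomes $\beta$ if $f_2(x)=1$, else $\max(\gamma-1,0)$. Attractors are periodic orbits: fixed points (length 1) and limit cycles (length $\ge2$). -}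

module Defs where

open import Data.Nat using (ℕ; zero; suc; _≤_; _⊔_; pred)
open import Data.Bool using (Bool; true; false; _∧_; _∨_)
open import Data.Product using (_×_; _,_; Σ; ∃)
open import Data.Sum using (_⊎_)
open import Relation.Binary.PropositionalEquality using (_≡_)

BN2 : Set
BN2 = (Bool → Bool → Bool) × (Bool → Bool → Bool)

-- Configurations (ρ , γ) of the MBN; the bounds ρ ≤ α, γ ≤ β are carried separately.
Config : Set
Config = ℕ × ℕ

InRange : ℕ → ℕ → Config → Set
InRange α β (ρ , γ) = (ρ ≤ α) × (γ ≤ β)

pos : ℕ → Bool
pos zero    = false
pos (suc _) = true

upd : ℕ → Bool → ℕ → ℕ
upd d true  r = d
upd d false r = pred r

step : BN2 → ℕ → ℕ → Config → Config
step (f₁ , f₂) α β (ρ , γ) =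
  upd α (f₁ (pos ρ) (pos γ)) ρ , upd β (f₂ (pos ρ) (pos γ)) γ

iterate : (Config → Config) → ℕ → Config → Config
iterate F zero    c = c
iterate F (suc k) c = F (iterate F k c)

-- c lies on a periodic orbit (attractor) of the MBN
IsPeriodic : BN2 → ℕ → ℕ → Config → Set
IsPeriodic N α β c = Σ ℕ λ k → iterate (step N α β) (suc k) c ≡ c

IsFixed : BN2 → ℕ → ℕ → Config → Set
IsFixed N α β c = step N α β c ≡ c

net1 net2 net3 : BN2
net1 = (λ x₁ x₂ → x₁ ∧ x₂) , (λ x₁ x₂ → x₂)
net2 = (λ x₁ x₂ → x₁ ∧ x₂) , (λ x₁ x₂ → x₁ ∨ x₂)
net3 = (λ x₁ x₂ → x₁)      , (λ x₁ x₂ → x₁ ∨ x₂)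

data IsProp19Net : BN2 → Set where
  is1 : IsProp19Net net1
  is2 : IsProp19Net net2
  is3 : IsProp19Net net3

-- Every configuration of these MBNs reaches a fixed point in finitely many
-- steps: usually a single step lands on one; otherwise, for net1 the first
-- delay counts down to (0,0), and for net2 two steps suffice. If c has period
-- k+1 and Fᵐ c = p is fixed, then c = F^(m(k+1)) c = F^(mk) p = p. The fixed
-- points themselves are read off by a case split on which coordinates are
-- positive.
{-# OPTIONS --safe #-}
module Submission where

open import Defs
open import Data.Nat using (ℕ; zero; suc; _≥_; _+_; _*_; s≤s)
open import Data.Nat.Properties using (*-suc; +-comm)
open import Data.Product using (_×_; _,_; Σ)
open import Data.Sum using (_⊎_; inj₁; inj₂)
open import Relation.Binary.PropositionalEquality
  using (_≡_; refl; sym; trans; cong; subst; module ≡-Reasoning)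
open import Function.Bundles using (_⇔_; mk⇔)

ReachesFixedPoint : (Config → Config) → Config → Set
ReachesFixedPoint F c =
  Σ ℕ λ m → Σ Config λ p → (iterate F m c ≡ p) × (F p ≡ p)

module _ (F : Config → Config) where

  iterate-suc′ : ∀ n c → iterate F (suc n) c ≡ iterate F n (F c)
  iterate-suc′ zero    c = refl
  iterate-suc′ (suc n) c = cong F (iterate-suc′ n c)

  iterate-+ : ∀ m n c → iterate F (m + n) c ≡ iterate F m (iterate F n c)
  iterate-+ zero    n c = refl
  iterate-+ (suc m) n c = cong F (iterate-+ m n c)

  iterate-fixed : ∀ n {p} → F p ≡ p → iterate F n p ≡ p
  iterate-fixed zero    fp = refl
  iterate-fixed (suc n) fp = trans (cong F (iterate-fixed n fp)) fp

  iterate-period-* : ∀ j n {c} → iterate F n c ≡ c → iterate F (j * n) c ≡ c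
  iterate-period-* zero    n e = refl
  iterate-period-* (suc j) n {c} e = begin
    iterate F (n + j * n) c           ≡⟨ iterate-+ n (j * n) c ⟩
    iterate F n (iterate F (j * n) c) ≡⟨ cong (iterate F n) (iterate-period-* j n e) ⟩
    iterate F n c                     ≡⟨ e ⟩
    c                                 ∎
    where open ≡-Reasoning

  periodic-reaching-fixed-point-is-it : ∀ k m {c p} → iterate F (suc k) c ≡ c →
    iterate F m c ≡ p → F p ≡ p → c ≡ p
  periodic-reaching-fixed-point-is-it k m {c} {p} periodic reach fp = begin
    c                                 ≡⟨ sym (iterate-period-* m (suc k) periodic) ⟩
    iterate F (m * suc k) c           ≡⟨ cong (λ n → iterate F n c) (trans (*-suc m k) (+-comm m (m * k))) ⟩
    iterate F (m * k + m) c           ≡⟨ iterate-+ (m * k) m c ⟩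
    iterate F (m * k) (iterate F m c) ≡⟨ cong (iterate F (m * k)) reach ⟩
    iterate F (m * k) p               ≡⟨ iterate-fixed (m * k) fp ⟩
    p                                 ∎
    where open ≡-Reasoning

  periodic-reaching-fixed-point-is-fixed : ∀ k {c} → iterate F (suc k) c ≡ c →
    ReachesFixedPoint F c → F c ≡ c
  periodic-reaching-fixed-point-is-fixed k periodic (m , p , reach , fp) =
    subst (λ z → F z ≡ z) (sym (periodic-reaching-fixed-point-is-it k m periodic reach fp)) fp

StableConfig : ℕ → ℕ → Config → Set
StableConfig α β c = (c ≡ (0 , 0)) ⊎ (c ≡ (0 , β)) ⊎ (c ≡ (α , β))

stable⇒fixed : ∀ {N} → IsProp19Net N → ∀ a b {c} →
  StableConfig (suc a) (suc b) c → step N (suc a) (suc b) c ≡ c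
stable⇒fixed is1 a b (inj₁ refl)        = refl
stable⇒fixed is2 a b (inj₁ refl)        = refl
stable⇒fixed is3 a b (inj₁ refl)        = refl
stable⇒fixed is1 a b (inj₂ (inj₁ refl)) = refl
stable⇒fixed is2 a b (inj₂ (inj₁ refl)) = refl
stable⇒fixed is3 a b (inj₂ (inj₁ refl)) = refl
stable⇒fixed is1 a b (inj₂ (inj₂ refl)) = refl
stable⇒fixed is2 a b (inj₂ (inj₂ refl)) = refl
stable⇒fixed is3 a b (inj₂ (inj₂ refl)) = refl

fixed⇒stable : ∀ {N} → IsProp19Net N → ∀ a b c →
  step N (suc a) (suc b) c ≡ c → StableConfig (suc a) (suc b) c
fixed⇒stable _   a b (zero  , zero)  e = inj₁ refl
fixed⇒stable is1 a b (zero  , suc g) e = inj₂ (inj₁ (sym e))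
fixed⇒stable is2 a b (zero  , suc g) e = inj₂ (inj₁ (sym e))
fixed⇒stable is3 a b (zero  , suc g) e = inj₂ (inj₁ (sym e))
fixed⇒stable is1 a b (suc r , zero)  ()
fixed⇒stable is2 a b (suc r , zero)  ()
fixed⇒stable is3 a b (suc r , zero)  ()
fixed⇒stable is1 a b (suc r , suc g) e = inj₂ (inj₂ (sym e))
fixed⇒stable is2 a b (suc r , suc g) e = inj₂ (inj₂ (sym e))
fixed⇒stable is3 a b (suc r , suc g) e = inj₂ (inj₂ (sym e))

net1-first-decays : ∀ a b r → iterate (step net1 (suc a) (suc b)) r (r , 0) ≡ (0 , 0)
net1-first-decays a b zero    = refl
net1-first-decays a b (suc r) =
  trans (iterate-suc′ (step net1 (suc a) (suc b)) r (suc r , 0)) (net1-first-decays a b r)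

reaches-fixed-point : ∀ {N} → IsProp19Net N → ∀ a b c →
  ReachesFixedPoint (step N (suc a) (suc b)) c
reaches-fixed-point is1 a b (r , zero)             = r , (0 , 0) , net1-first-decays a b r , refl
reaches-fixed-point is1 a b (zero , suc g)         = 1 , (0 , suc b) , refl , refl
reaches-fixed-point is1 a b (suc r , suc g)        = 1 , (suc a , suc b) , refl , refl
reaches-fixed-point is2 a b (zero , zero)          = 0 , (0 , 0) , refl , refl
reaches-fixed-point is2 a b (zero , suc g)         = 1 , (0 , suc b) , refl , refl
reaches-fixed-point is2 a b (suc zero , zero)      = 2 , (0 , suc b) , refl , refl
reaches-fixed-point is2 a b (suc (suc r) , zero)   = 2 , (suc a , suc b) , refl , refl
reaches-fixed-point is2 a b (suc r , suc g)        = 1 , (suc a , suc b) , refl , refl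
reaches-fixed-point is3 a b (zero , zero)          = 0 , (0 , 0) , refl , refl
reaches-fixed-point is3 a b (zero , suc g)         = 1 , (0 , suc b) , refl , refl
reaches-fixed-point is3 a b (suc r , g)            = 1 , (suc a , suc b) , refl , refl

proposition19 : (N : BN2) → IsProp19Net N → (α β : ℕ) → α ≥ 1 → β ≥ 1 →
    ((c : Config) → InRange α β c →
      IsPeriodic N α β c ⇔ ((c ≡ (0 , 0)) ⊎ (c ≡ (0 , β)) ⊎ (c ≡ (α , β))))
    × IsFixed N α β (0 , 0) × IsFixed N α β (0 , β) × IsFixed N α β (α , β)
proposition19 N net (suc a) (suc b) (s≤s _) (s≤s _) =
  (λ c _ → mk⇔ (periodic⇒stable c) (λ s → 0 , stable⇒fixed net a b s))
  , stable⇒fixed net a b (inj₁ refl)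
  , stable⇒fixed net a b (inj₂ (inj₁ refl))
  , stable⇒fixed net a b (inj₂ (inj₂ refl))
  where
  periodic⇒stable : ∀ c → IsPeriodic N (suc a) (suc b) c → StableConfig (suc a) (suc b) c
  periodic⇒stable c (k , periodic) =
    fixed⇒stable net a b c
      (periodic-reaching-fixed-point-is-fixed (step N (suc a) (suc b)) k periodic
        (reaches-fixed-point net a b c))
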